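{- Let $n\geq 0$ be an integer. Let $T_{n+1}$ be the number of triples $(P,M,c)$ where $P$ is a plane tree with $n+1$ edges, $M$ is a set of two distinct internal vertices of $P$, and $c$ assigns to each leaf of $P$ one of two colors. Then $T_{n+1}$ equals the number of triples $(P',M',c')$ where $P'$ is a plane tree with $n$ edges, $M'$ is a set of two distinct vertices of $P'$, and $c'$ assigns to each leaf of $P'$ one of two colors; moreover $$T_{n+1}=\binom{n+1}{2}S_n,\qquad\text{where } S_n=\sum_{k=1}^{n}N_{n,k}2^k .$$
   Context: A plane tree is a rooted tree in which the children of every vertex are linearly ordered; a vertex is internal if it has at least one child and a leaf otherwise. The Narayana numbers are $N_{n,k}=\frac{1}{n}\binom{n}{k}\binom{n}{k-1}$ for $n\geq 1$ (the empty sum $S_0$ is $0$). $S_n$ is the large Schröder number. -}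

module Defs where

open import Data.Nat using (ℕ; zero; suc; _+_; _*_; _∸_; _^_)
open import Data.Nat.DivMod using (_/_)
open import Data.Nat.Combinatorics using (_C_)
open import Data.List using (List; []; _∷_; _++_; length; lookup; map; upTo)
open import Data.Nat.ListAction using (sum)
open import Data.Unit using (⊤)
open import Data.Bool using (Bool; true; false; not; T)
open import Data.Fin using (Fin; _<_)
open import Data.Vec using (Vec)
open import Data.Product using (Σ; _×_)
open import Relation.Binary.PropositionalEquality using (_≡_)

data PTree : Set where
  node : List PTree → PTree

mutual
  edges : PTree → ℕ
  edges (node ts) = edgesF ts

  edgesF : List PTree → ℕ
  edgesF [] = 0
  edgesF (t ∷ ts) = suc (edges t) + edgesF ts

mutual
  -- the vertices of P listed in preorder; each entry records whether the
  -- vertex is internal (true) or a leaf (false)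
  shape : PTree → List Bool
  shape (node ts) = isCons ts ∷ shapeF ts
    where
    isCons : List PTree → Bool
    isCons [] = false
    isCons (_ ∷ _) = true

  shapeF : List PTree → List Bool
  shapeF [] = []
  shapeF (t ∷ ts) = shape t ++ shapeF ts

-- vertices of P, identified with their preorder positions
Vertex : PTree → Set
Vertex P = Fin (length (shape P))

internal : (P : PTree) → Vertex P → Bool
internal P v = lookup (shape P) v

countFalse : List Bool → ℕ
countFalse [] = 0
countFalse (true ∷ bs) = countFalse bs
countFalse (false ∷ bs) = suc (countFalse bs)

leaves : PTree → ℕ
leaves P = countFalse (shape P)

-- a 2-colouring of the leaves (leaves ordered by preorder)
Colouring : PTree → Set
Colouring P = Vec Bool (leaves P)

-- a set {i , j} of two distinct vertices, both satisfying `good`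
-- (represented canonically by i < j)
TwoSet : (P : PTree) → (Vertex P → Set) → Set
TwoSet P good = Σ (Vertex P) λ i → Σ (Vertex P) λ j → (i < j) × good i × good j

TriplesInternal : ℕ → Set
TriplesInternal m = Σ PTree λ P → (edges P ≡ m) × TwoSet P (λ v → T (internal P v)) × Colouring P

TriplesAny : ℕ → Set
TriplesAny m = Σ PTree λ P → (edges P ≡ m) × TwoSet P (λ _ → ⊤) × Colouring P

-- Narayana numbers N_{n,k} = (1/n) C(n,k) C(n,k-1) for n ≥ 1 (0 for n = 0)
narayana : ℕ → ℕ → ℕ
narayana zero k = 0
narayana (suc m) k = ((suc m C k) * (suc m C (k ∸ 1))) / suc m

schroder : ℕ → ℕ
schroder n = sum (map (λ k → narayana n (suc k) * 2 ^ suc k) (upTo n))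

module Submission where

-- Both kinds of triples are counted by grading plane trees
-- by their number of leaves.  A tree with e edges has e+1 vertices, and if it
-- has k leaves it has e+1−k internal vertices and 2^k leaf colourings, so
--   #TriplesAny n           = Σ_k N(n,k)·C(n+1,2)·2^k,
--   #TriplesInternal (n+1)  = Σ_k N(n+1,k)·C(n+2−k,2)·2^k,
-- where N(n,k) counts plane trees with n edges and k leaves.
-- To compute N we count plane forests by trees, edges and leaves through a
-- binary recursion realised by explicit bijections (split off a leading
-- single vertex, or cut the edge to the first child of the first root), and
-- prove a subtraction-free closed form for these counts by simultaneous
-- induction.  It yields the Narayana formula (n+1)·N(n+1,k+1) = C(n+1,k+1)·C(n+1,k)
-- and the transfer identity N(n+1,k)·C(n+2−k,2) = C(n+1,2)·N(n,k).  The
-- latter makes the two weighted sums agree term by term, and the first one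
-- equals C(n+1,2)·S_n.  Every count is an explicit bijection with a `Fin`,
-- so the bijection between the two kinds of triples is composed from them.

open import Defs
open import Data.Nat using (ℕ; zero; suc; _+_; _*_; _∸_; _^_; _≤_; _<_; z≤n; s≤s; _≟_)
open import Data.Nat.Properties
open import Data.Nat.Combinatorics using (_C_; nCk≡nC[n∸k]; nCn≡1; k>n⇒nCk≡0; nCk+nC[k+1]≡[n+1]C[k+1])
open import Data.Nat.DivMod using (_/_; m*n/n≡m)
open import Data.Nat.ListAction using (sum)
open import Data.Nat.Tactic.RingSolver using (solve-∀)
open import Data.Bool using (Bool; true; false; T)
open import Data.Unit using (⊤)
open import Data.Empty using (⊥; ⊥-elim)
open import Data.Fin using (Fin; zero; suc) renaming (_<_ to _<ᶠ_)
open import Data.Fin.Properties using (+↔⊎; *↔×; 1↔⊤; 2↔Bool)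
open import Data.Vec using (Vec; []; _∷_)
open import Data.List using (List; []; _∷_; _++_; length; lookup; map; applyUpTo)
open import Data.List.Properties using (length-++; ++-identityʳ)
open import Data.Product using (Σ; _×_; _,_)
open import Data.Sum using (_⊎_; inj₁; inj₂)
open import Data.Sum.Function.Propositional using (_⊎-↔_)
open import Data.Product.Function.NonDependent.Propositional using (_×-↔_)
open import Data.Product.Function.Dependent.Propositional using (Σ-↔)
open import Function using (_∘_)
open import Function.Bundles using (_↔_; mk↔ₛ′)
open import Function.Properties.Inverse using (↔-refl; ↔-sym; ↔-trans)
open import Relation.Nullary using (yes; no; contradiction)
open import Relation.Binary.PropositionalEquality
open ≡-Reasoning

-- Binomial coefficients by Pascal's rule, so that they compute by pattern
-- matching; `choose≡C` identifies them with the library's `_C_`.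
choose : ℕ → ℕ → ℕ
choose n       zero    = 1
choose zero    (suc k) = 0
choose (suc n) (suc k) = choose n k + choose n (suc k)

choose≡C : ∀ n k → n C k ≡ choose n k
choose≡C n       zero    = trans (nCk≡nC[n∸k] {0} {n} z≤n) (nCn≡1 n)
choose≡C zero    (suc k) = k>n⇒nCk≡0 {0} {suc k} (s≤s z≤n)
choose≡C (suc n) (suc k) =
  trans (sym (nCk+nC[k+1]≡[n+1]C[k+1] n k)) (cong₂ _+_ (choose≡C n k) (choose≡C n (suc k)))

choose-big : ∀ n k → n < k → choose n k ≡ 0
choose-big zero    (suc k) _         = refl
choose-big (suc n) (suc k) (s≤s n<k) =
  cong₂ _+_ (choose-big n k n<k) (choose-big n (suc k) (m<n⇒m<1+n n<k))

choose-diag : ∀ n → choose n n ≡ 1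
choose-diag zero    = refl
choose-diag (suc n) = cong₂ _+_ (choose-diag n) (choose-big n (suc n) (n<1+n n))

choose-1 : ∀ n → choose n 1 ≡ n
choose-1 zero    = refl
choose-1 (suc n) = cong suc (choose-1 n)

choose-absorb : ∀ n k → choose (suc n) (suc k) * suc k ≡ suc n * choose n k
choose-absorb n       zero    = cong (_* 1) (choose-1 (suc n))
choose-absorb zero    (suc k) = refl
choose-absorb (suc n) (suc k) = begin
  (X + Y) * suc (suc k)                               ≡⟨ split X Y k ⟩
  X + X * suc k + Y * suc (suc k)                     ≡⟨ cong₂ (λ a b → X + a + b) (choose-absorb n k) (choose-absorb n (suc k)) ⟩
  (p + q) + suc n * p + suc n * q                     ≡⟨ collect n p q ⟩
  suc (suc n) * (p + q)                               ∎
  where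
  X Y p q : ℕ
  X = choose (suc n) (suc k)
  Y = choose (suc n) (suc (suc k))
  p = choose n k
  q = choose n (suc k)
  split : ∀ X Y k → (X + Y) * suc (suc k) ≡ X + X * suc k + Y * suc (suc k)
  split = solve-∀
  collect : ∀ n p q → (p + q) + suc n * p + suc n * q ≡ suc (suc n) * (p + q)
  collect = solve-∀

choose-absorb∸ : ∀ n k → choose (suc n) k * (suc n ∸ k) ≡ suc n * choose n k
choose-absorb∸ n       zero    = *-comm 1 (suc n)
choose-absorb∸ zero    (suc k) = trans (cong (choose 1 (suc k) *_) (0∸n≡0 k)) (*-zeroʳ (choose 1 (suc k)))
choose-absorb∸ (suc n) (suc k) with k ≤? n
... | yes k≤n = begin
  (X + Y) * (suc n ∸ k)                               ≡⟨ cong ((X + Y) *_) (+-∸-assoc 1 k≤n) ⟩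
  (X + Y) * suc d                                     ≡⟨ split X Y d ⟩
  X * suc d + (Y * d + Y)                             ≡⟨ cong₂ (λ a b → a + (b + Y)) X-step (choose-absorb∸ n (suc k)) ⟩
  suc n * p + (suc n * q + (p + q))                   ≡⟨ collect n p q ⟩
  suc (suc n) * (p + q)                               ∎
  where
  X Y p q d : ℕ
  X = choose (suc n) k
  Y = choose (suc n) (suc k)
  p = choose n k
  q = choose n (suc k)
  d = n ∸ k
  X-step : X * suc d ≡ suc n * p
  X-step = trans (cong (X *_) (sym (+-∸-assoc 1 k≤n))) (choose-absorb∸ n k)
  split : ∀ X Y d → (X + Y) * suc d ≡ X * suc d + (Y * d + Y)
  split = solve-∀
  collect : ∀ n p q → suc n * p + (suc n * q + (p + q)) ≡ suc (suc n) * (p + q)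
  collect = solve-∀
... | no k≰n rewrite m≤n⇒m∸n≡0 (≰⇒> k≰n) | choose-big (suc n) (suc k) (s≤s (≰⇒> k≰n)) =
  trans (*-zeroʳ (choose (suc n) k + 0)) (sym (*-zeroʳ (suc (suc n))))

choose-2 : ∀ n → choose n 2 * 2 ≡ n * (n ∸ 1)
choose-2 zero    = refl
choose-2 (suc n) = trans (choose-absorb n 1) (cong (suc n *_) (choose-1 n))

Fin-cast : ∀ {a b} → a ≡ b → Fin a ↔ Fin b
Fin-cast refl = ↔-refl

empty↔ : ∀ {A : Set} → (A → ⊥) → A ↔ Fin 0
empty↔ ¬a = mk↔ₛ′ (λ a → ⊥-elim (¬a a)) (λ ()) (λ ()) (λ a → ⊥-elim (¬a a))

⊎-card : ∀ {A C : Set} {a c} → A ↔ Fin a → C ↔ Fin c → (A ⊎ C) ↔ Fin (a + c)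
⊎-card f g = ↔-trans (f ⊎-↔ g) (↔-sym +↔⊎)

×-card : ∀ {A C : Set} {a c} → A ↔ Fin a → C ↔ Fin c → (A × C) ↔ Fin (a * c)
×-card f g = ↔-trans (f ×-↔ g) (↔-sym *↔×)

bit : Bool → ℕ
bit true  = 1
bit false = 0

T-card : ∀ b → T b ↔ Fin (bit b)
T-card true  = ↔-sym 1↔⊤
T-card false = empty↔ (λ ())

colourings-card : ∀ k → Vec Bool k ↔ Fin (2 ^ k)
colourings-card zero    = mk↔ₛ′ (λ _ → zero) (λ _ → []) (λ { zero → refl }) (λ { [] → refl })
colourings-card (suc k) = ↔-trans uncons (×-card (↔-sym 2↔Bool) (colourings-card k))
  where
  uncons : Vec Bool (suc k) ↔ (Bool × Vec Bool k)
  uncons = mk↔ₛ′ (λ { (b ∷ bs) → b , bs }) (λ { (b , bs) → b ∷ bs }) (λ _ → refl) (λ { (b ∷ bs) → refl })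

count : (N : ℕ) → (Fin N → Bool) → ℕ
count zero    f = 0
count (suc N) f = bit (f zero) + count N (λ i → f (suc i))

Singles : (N : ℕ) → (Fin N → Bool) → Set
Singles N f = Σ (Fin N) λ i → T (f i)

Pairs : (N : ℕ) → (Fin N → Bool) → Set
Pairs N f = Σ (Fin N) λ i → Σ (Fin N) λ j → (i <ᶠ j) × T (f i) × T (f j)

split-Singles : ∀ N f → Singles (suc N) f ↔ (T (f zero) ⊎ Singles N (λ i → f (suc i)))
split-Singles N f = mk↔ₛ′
  (λ { (zero , p) → inj₁ p ; (suc i , p) → inj₂ (i , p) })
  (λ { (inj₁ p) → zero , p ; (inj₂ (i , p)) → suc i , p })
  (λ { (inj₁ p) → refl ; (inj₂ (i , p)) → refl })
  (λ { (zero , p) → refl ; (suc i , p) → refl })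

split-Pairs : ∀ N f →
  Pairs (suc N) f ↔ ((T (f zero) × Singles N (λ i → f (suc i))) ⊎ Pairs N (λ i → f (suc i)))
split-Pairs N f = mk↔ₛ′
  (λ { (zero , suc j , _ , p , q) → inj₁ (p , (j , q))
     ; (suc i , suc j , s≤s i<j , p , q) → inj₂ (i , j , i<j , p , q) })
  (λ { (inj₁ (p , (j , q))) → zero , suc j , s≤s z≤n , p , q
     ; (inj₂ (i , j , i<j , p , q)) → suc i , suc j , s≤s i<j , p , q })
  (λ { (inj₁ _) → refl ; (inj₂ _) → refl })
  (λ { (zero , suc j , s≤s z≤n , p , q) → refl ; (suc i , suc j , s≤s i<j , p , q) → refl })

Singles-card : ∀ N f → Singles N f ↔ Fin (count N f)
Singles-card zero    f = empty↔ (λ { (() , _) })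
Singles-card (suc N) f =
  ↔-trans (split-Singles N f) (⊎-card (T-card (f zero)) (Singles-card N (λ i → f (suc i))))

Pairs-card : ∀ N f → Pairs N f ↔ Fin (choose (count N f) 2)
Pairs-card zero    f = empty↔ (λ { (() , _) })
Pairs-card (suc N) f = ↔-trans (split-Pairs N f)
  (↔-trans (⊎-card (×-card (T-card (f zero)) (Singles-card N f⁺)) (Pairs-card N f⁺))
           (Fin-cast (pascal (f zero) (count N f⁺))))
  where
  f⁺ : Fin N → Bool
  f⁺ i = f (suc i)
  pascal : ∀ b c → bit b * c + choose c 2 ≡ choose (bit b + c) 2
  pascal true  c = cong (_+ choose c 2) (trans (+-identityʳ c) (sym (choose-1 c)))
  pascal false c = refl

countFalse-++ : ∀ xs ys → countFalse (xs ++ ys) ≡ countFalse xs + countFalse ys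
countFalse-++ []           ys = refl
countFalse-++ (true ∷ xs)  ys = countFalse-++ xs ys
countFalse-++ (false ∷ xs) ys = cong suc (countFalse-++ xs ys)

forestEdges : List PTree → ℕ
forestEdges []       = 0
forestEdges (t ∷ ts) = edges t + forestEdges ts

forestLeaves : List PTree → ℕ
forestLeaves []       = 0
forestLeaves (t ∷ ts) = leaves t + forestLeaves ts

HasStats : ℕ → ℕ → ℕ → List PTree → Set
HasStats r m k ts = (length ts ≡ r) × (forestEdges ts ≡ m) × (forestLeaves ts ≡ k)

HasStats-irrelevant : ∀ {x y z r m k : ℕ} (p q : (x ≡ r) × (y ≡ m) × (z ≡ k)) → p ≡ q
HasStats-irrelevant (a , b , c) (a′ , b′ , c′) =
  cong₂ _,_ (≡-irrelevant a a′) (cong₂ _,_ (≡-irrelevant b b′) (≡-irrelevant c c′))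

Forests : ℕ → ℕ → ℕ → Set
Forests r m k = Σ (List PTree) (HasStats r m k)

Forests° : ℕ → ℕ → ℕ → Set
Forests° r m k = Σ (List PTree) λ rest → HasStats (suc r) m k (node [] ∷ rest)

Forests⁺ : ℕ → ℕ → ℕ → Set
Forests⁺ r m k =
  Σ PTree λ c → Σ (List PTree) λ cs → Σ (List PTree) λ rest → HasStats r m k (node (c ∷ cs) ∷ rest)

-- The numbers of forests of the two kinds, by the recursion that the
-- bijections below realise.
forests  : ℕ → ℕ → ℕ → ℕ
forests⁺ : ℕ → ℕ → ℕ → ℕ
forests zero    zero    zero    = 1
forests zero    zero    (suc k) = 0
forests zero    (suc m) k       = 0
forests (suc r) m       zero    = forests⁺ (suc r) m zero
forests (suc r) m       (suc k) = forests r m k + forests⁺ (suc r) m (suc k)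
forests⁺ zero    m       k = 0
forests⁺ (suc r) zero    k = 0
forests⁺ (suc r) (suc m) k = forests (suc r) m k + forests⁺ (suc (suc r)) m k

split-first-tree : ∀ r m k → Forests (suc r) m k ↔ (Forests° r m k ⊎ Forests⁺ (suc r) m k)
split-first-tree r m k = mk↔ₛ′
  (λ { (node [] ∷ rest , p) → inj₁ (rest , p) ; (node (c ∷ cs) ∷ rest , p) → inj₂ (c , cs , rest , p) })
  (λ { (inj₁ (rest , p)) → node [] ∷ rest , p ; (inj₂ (c , cs , rest , p)) → node (c ∷ cs) ∷ rest , p })
  (λ { (inj₁ _) → refl ; (inj₂ _) → refl })
  (λ { (node [] ∷ _ , _) → refl ; (node (_ ∷ _) ∷ _ , _) → refl })

remove-leaf : ∀ r m k → Forests° r m (suc k) ↔ Forests r m k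
remove-leaf r m k = mk↔ₛ′
  (λ { (rest , (l , e , f)) → rest , (suc-injective l , e , suc-injective f) })
  (λ { (rest , (l , e , f)) → rest , (cong suc l , e , cong suc f) })
  (λ { (rest , p) → cong (rest ,_) (HasStats-irrelevant _ p) })
  (λ { (rest , p) → cong (rest ,_) (HasStats-irrelevant _ p) })

no-leaf-first : ∀ r m → Forests° r m 0 → ⊥
no-leaf-first r m (_ , (_ , _ , ()))

no-tree-forest : ∀ m k → Forests⁺ 0 m k → ⊥
no-tree-forest m k (_ , _ , _ , (() , _))

no-edge-forest : ∀ r k → Forests⁺ (suc r) 0 k → ⊥
no-edge-forest r k (_ , _ , _ , (_ , () , _))

-- Cutting the edge from the root of the first tree to its first child c
-- makes c a tree of its own: if c was the only child, the root disappears;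
-- otherwise c is placed second.  Either way one edge is lost, and leaves are kept.
lone-child-edges : ∀ c rest → forestEdges (node (c ∷ []) ∷ rest) ≡ suc (forestEdges (c ∷ rest))
lone-child-edges c rest = cong (λ z → suc (z + forestEdges rest)) (+-identityʳ (edges c))

lone-child-leaves : ∀ c rest → forestLeaves (node (c ∷ []) ∷ rest) ≡ forestLeaves (c ∷ rest)
lone-child-leaves c rest = cong (λ z → countFalse z + forestLeaves rest) (++-identityʳ (shape c))

swap-summands : ∀ a b x → (a + b) + x ≡ b + (a + x)
swap-summands = solve-∀

first-child-edges : ∀ c d ds rest →
  forestEdges (node (c ∷ d ∷ ds) ∷ rest) ≡ suc (forestEdges (node (d ∷ ds) ∷ c ∷ rest))
first-child-edges c d ds rest = cong suc (swap-summands (edges c) (edgesF (d ∷ ds)) (forestEdges rest))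

first-child-leaves : ∀ c d ds rest →
  forestLeaves (node (c ∷ d ∷ ds) ∷ rest) ≡ forestLeaves (node (d ∷ ds) ∷ c ∷ rest)
first-child-leaves c d ds rest =
  trans (cong (_+ forestLeaves rest) (countFalse-++ (shape c) (shapeF (d ∷ ds))))
        (swap-summands (leaves c) _ (forestLeaves rest))

peel-first-child : ∀ r m k →
  Forests⁺ (suc r) (suc m) k ↔ (Forests (suc r) m k ⊎ Forests⁺ (suc (suc r)) m k)
peel-first-child r m k = mk↔ₛ′ peel unpeel peel∘unpeel unpeel∘peel
  where
  peel : Forests⁺ (suc r) (suc m) k → Forests (suc r) m k ⊎ Forests⁺ (suc (suc r)) m k
  peel (c , [] , rest , (l , e , f)) =
    inj₁ (c ∷ rest , (l , suc-injective (trans (sym (lone-child-edges c rest)) e)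
                        , trans (sym (lone-child-leaves c rest)) f))
  peel (c , d ∷ ds , rest , (l , e , f)) =
    inj₂ (d , ds , c ∷ rest , (cong suc l , suc-injective (trans (sym (first-child-edges c d ds rest)) e)
                             , trans (sym (first-child-leaves c d ds rest)) f))
  unpeel : Forests (suc r) m k ⊎ Forests⁺ (suc (suc r)) m k → Forests⁺ (suc r) (suc m) k
  unpeel (inj₁ (c ∷ rest , (l , e , f))) =
    c , [] , rest , (l , trans (lone-child-edges c rest) (cong suc e) , trans (lone-child-leaves c rest) f)
  unpeel (inj₂ (d , ds , c ∷ rest , (l , e , f))) =
    c , d ∷ ds , rest , (suc-injective l , trans (first-child-edges c d ds rest) (cong suc e)
                        , trans (first-child-leaves c d ds rest) f)
  peel∘unpeel : ∀ y → peel (unpeel y) ≡ y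
  peel∘unpeel (inj₁ (c ∷ rest , p))           = cong (λ q → inj₁ (c ∷ rest , q)) (HasStats-irrelevant _ p)
  peel∘unpeel (inj₂ (d , ds , c ∷ rest , p)) = cong (λ q → inj₂ (d , ds , c ∷ rest , q)) (HasStats-irrelevant _ p)
  unpeel∘peel : ∀ x → unpeel (peel x) ≡ x
  unpeel∘peel (c , []     , rest , p) = cong (λ q → c , [] , rest , q) (HasStats-irrelevant _ p)
  unpeel∘peel (c , d ∷ ds , rest , p) = cong (λ q → c , d ∷ ds , rest , q) (HasStats-irrelevant _ p)

Forests-card  : ∀ r m k → Forests r m k ↔ Fin (forests r m k)
Forests⁺-card : ∀ r m k → Forests⁺ r m k ↔ Fin (forests⁺ r m k)
Forests-card zero zero zero = mk↔ₛ′ (λ _ → zero) (λ _ → [] , refl , refl , refl) (λ { zero → refl })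
  (λ { ([] , p) → cong ([] ,_) (HasStats-irrelevant _ p) })
Forests-card zero zero    (suc k) = empty↔ (λ { ([] , (_ , _ , ())) })
Forests-card zero (suc m) k       = empty↔ (λ { ([] , (_ , () , _)) })
Forests-card (suc r) m zero = ↔-trans (split-first-tree r m zero)
  (⊎-card (empty↔ (no-leaf-first r m)) (Forests⁺-card (suc r) m zero))
Forests-card (suc r) m (suc k) = ↔-trans (split-first-tree r m (suc k))
  (⊎-card (↔-trans (remove-leaf r m k) (Forests-card r m k)) (Forests⁺-card (suc r) m (suc k)))
Forests⁺-card zero    m       k = empty↔ (no-tree-forest m k)
Forests⁺-card (suc r) zero    k = empty↔ (no-edge-forest r k)
Forests⁺-card (suc r) (suc m) k = ↔-trans (peel-first-child r m k)
  (⊎-card (Forests-card (suc r) m k) (Forests⁺-card (suc (suc r)) m k))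

-- C(n, k − t), read as 0 when t > k.
chooseSub : ℕ → ℕ → ℕ → ℕ
chooseSub n k       zero    = choose n k
chooseSub n zero    (suc t) = 0
chooseSub n (suc k) (suc t) = chooseSub n k t

chooseSub-pascal : ∀ n k t → chooseSub (suc n) k t ≡ chooseSub n k t + chooseSub n k (suc t)
chooseSub-pascal n zero    zero    = refl
chooseSub-pascal n (suc k) zero    = +-comm (choose n k) (choose n (suc k))
chooseSub-pascal n zero    (suc t) = refl
chooseSub-pascal n (suc k) (suc t) = chooseSub-pascal n k t

chooseSub0-diag : ∀ k → chooseSub 0 k k ≡ 1
chooseSub0-diag zero    = refl
chooseSub0-diag (suc k) = chooseSub0-diag k

chooseSub0-off : ∀ k t → k ≢ t → chooseSub 0 k t ≡ 0
chooseSub0-off zero    zero    k≢t = contradiction refl k≢t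
chooseSub0-off (suc k) zero    k≢t = refl
chooseSub0-off zero    (suc t) k≢t = refl
chooseSub0-off (suc k) (suc t) k≢t = chooseSub0-off k t (k≢t ∘ cong suc)

-- A forest of s trees without edges consists of s single vertices.
forests-edgeless : ∀ s k → forests s 0 k ≡ chooseSub 0 k s
forests-edgeless zero    zero    = refl
forests-edgeless zero    (suc k) = refl
forests-edgeless (suc s) zero    = refl
forests-edgeless (suc s) (suc k) = trans (+-identityʳ (forests s 0 k)) (forests-edgeless s k)

-- The forest counts have the subtraction-free closed forms
--   forests r (m+1) k  + C(m+r,k)·C(m,k−r−1) = C(m+r,k−1)·C(m,k−r),
--   forests⁺ (r+1) (m+1) k + C(m+r,k)·C(m,k−r−2) = C(m+r,k−1)·C(m,k−r−1),
-- proved by a simultaneous induction following the recursion for the counts.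
-- The two algebraic steps of that induction:
add-relations₁ : ∀ f g a b c x y →
  f + b * y ≡ a * x → g + c * y ≡ b * x → (f + g) + (b + c) * y ≡ (b + a) * x
add-relations₁ f g a b c x y e₁ e₂ = begin
  (f + g) + (b + c) * y     ≡⟨ regroup f g b c y ⟩
  (f + b * y) + (g + c * y) ≡⟨ cong₂ _+_ e₁ e₂ ⟩
  a * x + b * x             ≡⟨ +-comm (a * x) (b * x) ⟩
  b * x + a * x             ≡⟨ *-distribʳ-+ x b a ⟨
  (b + a) * x               ∎
  where
  regroup : ∀ f g b c y → (f + g) + (b + c) * y ≡ (f + b * y) + (g + c * y)
  regroup = solve-∀

add-relations₂ : ∀ f g p q u v w →
  f + p * v ≡ q * u → g + p * w ≡ q * v → (f + g) + p * (v + w) ≡ q * (u + v)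
add-relations₂ f g p q u v w e₁ e₂ = begin
  (f + g) + p * (v + w)     ≡⟨ regroup f g p v w ⟩
  (f + p * v) + (g + p * w) ≡⟨ cong₂ _+_ e₁ e₂ ⟩
  q * u + q * v             ≡⟨ *-distribˡ-+ q u v ⟨
  q * (u + v)               ∎
  where
  regroup : ∀ f g p v w → (f + g) + p * (v + w) ≡ (f + p * v) + (g + p * w)
  regroup = solve-∀

-- The base case m = 0 of the second closed form: [k = r+1] + C(r,k)·[k = r+2] = C(r,k−1)·[k = r+1].
closed-form-base : ∀ r k →
  chooseSub 0 k (suc r) + choose r k * chooseSub 0 k (suc (suc r)) ≡ chooseSub r k 1 * chooseSub 0 k (suc r)
closed-form-base r zero = refl
closed-form-base r (suc k) with k ≟ r
... | yes refl = begin
  chooseSub 0 k k + choose k (suc k) * chooseSub 0 k (suc k) ≡⟨ cong₂ (λ a b → a + choose k (suc k) * b)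
                                                                      (chooseSub0-diag k) (chooseSub0-off k (suc k) (1+n≢n ∘ sym)) ⟩
  1 + choose k (suc k) * 0                                   ≡⟨ cong suc (*-zeroʳ (choose k (suc k))) ⟩
  1                                                          ≡⟨ cong₂ _*_ (choose-diag k) (chooseSub0-diag k) ⟨
  choose k k * chooseSub 0 k k                               ∎
... | no k≢r = begin
  chooseSub 0 k r + choose r (suc k) * chooseSub 0 k (suc r) ≡⟨ cong (_+ choose r (suc k) * chooseSub 0 k (suc r)) (chooseSub0-off k r k≢r) ⟩
  choose r (suc k) * chooseSub 0 k (suc r)                   ≡⟨ beyond k ⟩
  0                                                          ≡⟨ *-zeroʳ (choose r k) ⟨
  choose r k * 0                                             ≡⟨ cong (choose r k *_) (chooseSub0-off k r k≢r) ⟨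
  choose r k * chooseSub 0 k r                               ∎
  where
  beyond : ∀ k → choose r (suc k) * chooseSub 0 k (suc r) ≡ 0
  beyond k with k ≟ suc r
  ... | yes refl = cong (_* chooseSub 0 (suc r) (suc r)) (choose-big r (suc (suc r)) (m<n⇒m<1+n (n<1+n r)))
  ... | no k≢1+r = trans (cong (choose r (suc k) *_) (chooseSub0-off k (suc r) k≢1+r)) (*-zeroʳ (choose r (suc k)))

forests-closed : ∀ r m k →
  forests r (suc m) k + choose (r + m) k * chooseSub m k (suc r) ≡ chooseSub (r + m) k 1 * chooseSub m k r
forests⁺-closed : ∀ r m k →
  forests⁺ (suc r) (suc m) k + choose (r + m) k * chooseSub m k (suc (suc r)) ≡ chooseSub (r + m) k 1 * chooseSub m k (suc r)
forests-closed zero    m k       = *-comm (choose m k) (chooseSub m k 1)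
forests-closed (suc r) m zero    = forests⁺-closed r m zero
forests-closed (suc r) m (suc k) =
  trans (add-relations₁ (forests r (suc m) k) (forests⁺ (suc r) (suc m) (suc k))
                        (chooseSub (r + m) k 1) (choose (r + m) k) (choose (r + m) (suc k))
                        (chooseSub m k r) (chooseSub m k (suc r))
                        (forests-closed r m k) (forests⁺-closed r m (suc k)))
        (cong (_* chooseSub m k r) (sym (chooseSub-pascal (r + m) k 0)))
forests⁺-closed r zero k rewrite +-identityʳ r =
  trans (cong (_+ choose r k * chooseSub 0 k (suc (suc r)))
              (trans (+-identityʳ _) (forests-edgeless (suc r) k)))
        (closed-form-base r k)
forests⁺-closed r (suc m) k
  rewrite +-suc r m | chooseSub-pascal m k (suc (suc r)) | chooseSub-pascal m k (suc r) =
  add-relations₂ (forests (suc r) (suc m) k) (forests⁺ (suc (suc r)) (suc m) k)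
                 (choose (suc (r + m)) k) (chooseSub (suc (r + m)) k 1)
                 (chooseSub m k (suc r)) (chooseSub m k (suc (suc r))) (chooseSub m k (suc (suc (suc r))))
                 (forests-closed (suc r) m k) (forests⁺-closed (suc r) m k)

trees : ℕ → ℕ → ℕ
trees m k = forests 1 m k

trees-leafless : ∀ m → trees (suc m) 0 ≡ 0
trees-leafless m = trans (sym (+-identityʳ _)) (forests-closed 1 m 0)

-- The Narayana formula (m+1)·N(m+1,j+1) = C(m+1,j+1)·C(m+1,j), from the
-- closed form  N(m+1,j+1) + C(m+1,j+1)·C(m,j−1) = C(m+1,j)·C(m,j)
-- and absorption.
trees-narayana : ∀ m j → suc m * trees (suc m) (suc j) ≡ choose (suc m) (suc j) * choose (suc m) j
trees-narayana m j = from-closed j (forests-closed 1 m (suc j))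
  where
  from-closed : ∀ j → trees (suc m) (suc j) + choose (suc m) (suc j) * chooseSub m j 1 ≡ choose (suc m) j * choose m j →
                suc m * trees (suc m) (suc j) ≡ choose (suc m) (suc j) * choose (suc m) j
  from-closed zero e = begin
    suc m * trees (suc m) 1 ≡⟨ cong (suc m *_) single-leaf ⟩
    suc m * 1               ≡⟨ cong (_* 1) (choose-1 (suc m)) ⟨
    choose (suc m) 1 * 1    ∎
    where
    single-leaf : trees (suc m) 1 ≡ 1
    single-leaf = trans (sym (trans (cong (trees (suc m) 1 +_) (*-zeroʳ (choose (suc m) 1))) (+-identityʳ _))) e
  from-closed (suc i) e = +-cancelʳ-≡ (X * suc i) (suc m * Nt) X (begin
    suc m * Nt + X * suc i                      ≡⟨ cong (suc m * Nt +_) (trans (*-assoc b a (suc i)) (cong (b *_) (choose-absorb m i))) ⟩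
    suc m * Nt + b * (suc m * choose m i)       ≡⟨ factor (suc m) Nt b (choose m i) ⟩
    suc m * (Nt + b * choose m i)               ≡⟨ cong (suc m *_) e ⟩
    suc m * (a * choose m (suc i))              ≡⟨ swap (suc m) a (choose m (suc i)) ⟩
    a * (suc m * choose m (suc i))              ≡⟨ cong (a *_) (choose-absorb m (suc i)) ⟨
    a * (b * suc (suc i))                       ≡⟨ expand a b i ⟩
    X + X * suc i                               ∎)
    where
    Nt a b X : ℕ
    Nt = trees (suc m) (suc (suc i))
    a = choose (suc m) (suc i)
    b = choose (suc m) (suc (suc i))
    X = b * a
    factor : ∀ s t b c → s * t + b * (s * c) ≡ s * (t + b * c)
    factor = solve-∀
    swap : ∀ s a c → s * (a * c) ≡ a * (s * c)
    swap = solve-∀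
    expand : ∀ a b i → a * (b * suc (suc i)) ≡ b * a + b * a * suc i
    expand = solve-∀

narayana≡trees : ∀ m j → narayana (suc m) (suc j) ≡ trees (suc m) (suc j)
narayana≡trees m j = begin
  narayana (suc m) (suc j)                                ≡⟨ cong₂ (λ a b → (a * b) / suc m) (choose≡C (suc m) (suc j)) (choose≡C (suc m) j) ⟩
  (choose (suc m) (suc j) * choose (suc m) j) / suc m     ≡⟨ cong (_/ suc m) (trees-narayana m j) ⟨
  (suc m * trees (suc m) (suc j)) / suc m                 ≡⟨ cong (_/ suc m) (*-comm (suc m) (trees (suc m) (suc j))) ⟩
  (trees (suc m) (suc j) * suc m) / suc m                 ≡⟨ m*n/n≡m (trees (suc m) (suc j)) (suc m) ⟩
  trees (suc m) (suc j)                                   ∎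

trees-overfull : ∀ m → trees (suc m) (suc (suc m)) ≡ 0
trees-overfull m = *-cancelˡ-≡ (trees (suc m) (suc (suc m))) 0 (suc m) (begin
  suc m * trees (suc m) (suc (suc m))                       ≡⟨ trees-narayana m (suc m) ⟩
  choose (suc m) (suc (suc m)) * choose (suc m) (suc m)     ≡⟨ cong (_* choose (suc m) (suc m)) (choose-big (suc m) (suc (suc m)) (n<1+n (suc m))) ⟩
  0                                                         ≡⟨ *-zeroʳ (suc m) ⟨
  suc m * 0                                                 ∎)

-- The transfer identity N(n+1,k)·C(n+2−k,2) = C(n+1,2)·N(n,k): a tree with
-- n+1 edges and k leaves has n+2−k internal vertices.  After multiplying
-- by 2(n+2) it follows from the Narayana formula and absorption.
trees-transfer : ∀ n k → trees (suc n) k * choose (suc (suc n) ∸ k) 2 ≡ choose (suc n) 2 * trees n k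
trees-transfer zero    zero          = refl
trees-transfer zero    (suc zero)    = *-zeroʳ (trees 1 1)
trees-transfer zero    (suc (suc k)) = trans (cong (λ z → trees 1 (suc (suc k)) * choose z 2) (0∸n≡0 k)) (*-zeroʳ (trees 1 (suc (suc k))))
trees-transfer (suc m) zero rewrite trees-leafless (suc m) | trees-leafless m = sym (*-zeroʳ (choose (suc (suc m)) 2))
trees-transfer (suc m) (suc j) = *-cancelˡ-≡ (P * choose d 2) (choose s 2 * Q) (s * 2) (begin
  (s * 2) * (P * choose d 2)       ≡⟨ regroup₁ s P (choose d 2) ⟩
  (s * P) * (choose d 2 * 2)       ≡⟨ cong₂ _*_ (trees-narayana (suc m) j) (choose-2 d) ⟩
  (v * u) * (d * (d ∸ 1))          ≡⟨ regroup₂ v u d (d ∸ 1) ⟩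
  (u * d) * (v * (d ∸ 1))          ≡⟨ cong₂ _*_ (choose-absorb∸ (suc m) j) (trans (cong (v *_) d-1) (choose-absorb∸ (suc m) (suc j))) ⟩
  (s * p) * (s * q)                ≡⟨ regroup₃ s p q ⟩
  s * s * (q * p)                  ≡⟨ cong (s * s *_) (trees-narayana m j) ⟨
  s * s * (suc m * Q)              ≡⟨ regroup₄ s (suc m) Q ⟩
  s * (s * suc m) * Q              ≡⟨ cong (λ z → s * z * Q) (choose-2 s) ⟨
  s * (choose s 2 * 2) * Q         ≡⟨ regroup₅ s (choose s 2) Q ⟩
  (s * 2) * (choose s 2 * Q)       ∎)
  where
  s d P Q u v p q : ℕ
  s = suc (suc m)
  d = s ∸ j
  P = trees s (suc j)
  Q = trees (suc m) (suc j)
  u = choose s j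
  v = choose s (suc j)
  p = choose (suc m) j
  q = choose (suc m) (suc j)
  d-1 : d ∸ 1 ≡ s ∸ suc j
  d-1 = trans (∸-+-assoc s j 1) (cong (s ∸_) (+-comm j 1))
  regroup₁ : ∀ s P b → (s * 2) * (P * b) ≡ (s * P) * (b * 2)
  regroup₁ = solve-∀
  regroup₂ : ∀ v u d e → (v * u) * (d * e) ≡ (u * d) * (v * e)
  regroup₂ = solve-∀
  regroup₃ : ∀ s p q → (s * p) * (s * q) ≡ s * s * (q * p)
  regroup₃ = solve-∀
  regroup₄ : ∀ s t Q → s * s * (t * Q) ≡ s * (s * t) * Q
  regroup₄ = solve-∀
  regroup₅ : ∀ s b Q → s * (b * 2) * Q ≡ (s * 2) * (b * Q)
  regroup₅ = solve-∀

sumBelow : ℕ → (ℕ → ℕ) → ℕ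
sumBelow zero    f = 0
sumBelow (suc N) f = f 0 + sumBelow N (λ k → f (suc k))

sumBelow-last : ∀ N f → sumBelow (suc N) f ≡ sumBelow N f + f N
sumBelow-last zero    f = +-comm (f 0) 0
sumBelow-last (suc N) f = trans (cong (f 0 +_) (sumBelow-last N (λ k → f (suc k)))) (sym (+-assoc (f 0) _ _))

sumBelow-cong : ∀ N {f g} → (∀ k → f k ≡ g k) → sumBelow N f ≡ sumBelow N g
sumBelow-cong zero    f≗g = refl
sumBelow-cong (suc N) f≗g = cong₂ _+_ (f≗g 0) (sumBelow-cong N (λ k → f≗g (suc k)))

sumBelow-* : ∀ N c f → sumBelow N (λ k → c * f k) ≡ c * sumBelow N f
sumBelow-* zero    c f = sym (*-zeroʳ c)
sumBelow-* (suc N) c f =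
  trans (cong (c * f 0 +_) (sumBelow-* N c (λ k → f (suc k)))) (sym (*-distribˡ-+ c (f 0) _))

sum-applyUpTo : ∀ N (f h : ℕ → ℕ) → sum (map h (applyUpTo f N)) ≡ sumBelow N (λ k → h (f k))
sum-applyUpTo zero    f h = refl
sum-applyUpTo (suc N) f h = cong (h (f 0) +_) (sum-applyUpTo N (λ k → f (suc k)) h)

-- Σ_k N(n,k)·h(k) over all leaf numbers k ≤ n+1 that a tree with n edges can have.
treeSum : ℕ → (ℕ → ℕ) → ℕ
treeSum n h = sumBelow (suc (suc n)) (λ k → trees n k * h k)

-- For n ≥ 1 the Schröder number is the leaf-weighted tree count Σ_k N(n,k)·2^k;
-- the extra terms k = 0 and k = n+1 vanish.
schroder-treeSum : ∀ m → schroder (suc m) ≡ treeSum (suc m) (2 ^_)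
schroder-treeSum m = begin
  schroder (suc m)                   ≡⟨ sum-applyUpTo (suc m) (λ k → k) term ⟩
  sumBelow (suc m) term              ≡⟨ sumBelow-cong (suc m) (λ k → cong (_* 2 ^ suc k) (narayana≡trees m k)) ⟩
  sumBelow (suc m) g                 ≡⟨ +-identityʳ _ ⟨
  sumBelow (suc m) g + 0             ≡⟨ cong (λ z → sumBelow (suc m) g + z * 2 ^ suc (suc m)) (trees-overfull m) ⟨
  sumBelow (suc m) g + g (suc m)     ≡⟨ sumBelow-last (suc m) g ⟨
  sumBelow (suc (suc m)) g           ≡⟨ cong (λ z → z * 1 + sumBelow (suc (suc m)) g) (trees-leafless m) ⟨
  treeSum (suc m) (2 ^_)             ∎
  where
  term g : ℕ → ℕ
  term k = narayana (suc m) (suc k) * 2 ^ suc k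
  g k = trees (suc m) (suc k) * 2 ^ suc k

-- The weighted sum for the triples (P′, M′, c′): every one of the n+1
-- vertices may be marked.
treeSum-any : ∀ n → treeSum n (λ k → choose (suc n) 2 * 2 ^ k) ≡ choose (suc n) 2 * schroder n
treeSum-any n = begin
  treeSum n (λ k → choose (suc n) 2 * 2 ^ k) ≡⟨ sumBelow-cong (suc (suc n)) (λ k → swap (trees n k) (choose (suc n) 2) (2 ^ k)) ⟩
  sumBelow (suc (suc n)) (λ k → choose (suc n) 2 * (trees n k * 2 ^ k)) ≡⟨ sumBelow-* (suc (suc n)) (choose (suc n) 2) (λ k → trees n k * 2 ^ k) ⟩
  choose (suc n) 2 * treeSum n (2 ^_)        ≡⟨ schroder-weight n ⟩
  choose (suc n) 2 * schroder n              ∎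
  where
  swap : ∀ a c t → a * (c * t) ≡ c * (a * t)
  swap = solve-∀
  schroder-weight : ∀ n → choose (suc n) 2 * treeSum n (2 ^_) ≡ choose (suc n) 2 * schroder n
  schroder-weight zero    = refl
  schroder-weight (suc m) = cong (choose (suc (suc m)) 2 *_) (sym (schroder-treeSum m))

-- The weighted sum for the triples (P, M, c): a tree with n+1 edges and k
-- leaves has C(n+2−k,2) pairs of internal vertices.  The transfer identity
-- turns it into the previous sum.
treeSum-internal : ∀ n → treeSum (suc n) (λ k → choose (suc (suc n) ∸ k) 2 * 2 ^ k) ≡ choose (suc n) 2 * schroder n
treeSum-internal n = begin
  sumBelow (suc (suc (suc n))) f           ≡⟨ sumBelow-last (suc (suc n)) f ⟩
  sumBelow (suc (suc n)) f + f (suc (suc n)) ≡⟨ cong (λ z → sumBelow (suc (suc n)) f + z * (choose (suc (suc n) ∸ suc (suc n)) 2 * 2 ^ suc (suc n))) (trees-overfull n) ⟩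
  sumBelow (suc (suc n)) f + 0             ≡⟨ +-identityʳ _ ⟩
  sumBelow (suc (suc n)) f                 ≡⟨ sumBelow-cong (suc (suc n)) transfer ⟩
  treeSum n (λ k → choose (suc n) 2 * 2 ^ k) ≡⟨ treeSum-any n ⟩
  choose (suc n) 2 * schroder n            ∎
  where
  f : ℕ → ℕ
  f k = trees (suc n) k * (choose (suc (suc n) ∸ k) 2 * 2 ^ k)
  assoc : ∀ a b t → a * (b * t) ≡ (a * b) * t
  assoc = solve-∀
  transfer : ∀ k → f k ≡ trees n k * (choose (suc n) 2 * 2 ^ k)
  transfer k = begin
    trees (suc n) k * (choose (suc (suc n) ∸ k) 2 * 2 ^ k) ≡⟨ assoc (trees (suc n) k) _ (2 ^ k) ⟩
    (trees (suc n) k * choose (suc (suc n) ∸ k) 2) * 2 ^ k ≡⟨ cong (_* 2 ^ k) (trees-transfer n k) ⟩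
    (choose (suc n) 2 * trees n k) * 2 ^ k                 ≡⟨ cong (_* 2 ^ k) (*-comm (choose (suc n) 2) (trees n k)) ⟩
    (trees n k * choose (suc n) 2) * 2 ^ k                 ≡⟨ assoc (trees n k) (choose (suc n) 2) (2 ^ k) ⟨
    trees n k * (choose (suc n) 2 * 2 ^ k)                 ∎

countTrue : List Bool → ℕ
countTrue []           = 0
countTrue (true ∷ bs)  = suc (countTrue bs)
countTrue (false ∷ bs) = countTrue bs

countTrue+countFalse : ∀ bs → countTrue bs + countFalse bs ≡ length bs
countTrue+countFalse []           = refl
countTrue+countFalse (true ∷ bs)  = cong suc (countTrue+countFalse bs)
countTrue+countFalse (false ∷ bs) = trans (+-suc (countTrue bs) (countFalse bs)) (cong suc (countTrue+countFalse bs))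

countFalse≤length : ∀ bs → countFalse bs ≤ length bs
countFalse≤length []           = z≤n
countFalse≤length (true ∷ bs)  = m≤n⇒m≤1+n (countFalse≤length bs)
countFalse≤length (false ∷ bs) = s≤s (countFalse≤length bs)

count-lookup : ∀ bs → count (length bs) (lookup bs) ≡ countTrue bs
count-lookup []           = refl
count-lookup (true ∷ bs)  = cong suc (count-lookup bs)
count-lookup (false ∷ bs) = count-lookup bs

count-true : ∀ N → count N (λ _ → true) ≡ N
count-true zero    = refl
count-true (suc N) = cong suc (count-true N)

vertex-count  : ∀ P → length (shape P) ≡ suc (edges P)
vertex-countF : ∀ ts → length (shapeF ts) ≡ edgesF ts
vertex-count (node ts) = cong suc (vertex-countF ts)
vertex-countF []       = refl
vertex-countF (t ∷ ts) = trans (length-++ (shape t)) (cong₂ _+_ (vertex-count t) (vertex-countF ts))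

leaves≤vertices : ∀ P → leaves P ≤ suc (edges P)
leaves≤vertices P = subst (leaves P ≤_) (vertex-count P) (countFalse≤length (shape P))

internal-count : ∀ P → count (length (shape P)) (internal P) ≡ suc (edges P) ∸ leaves P
internal-count P = begin
  count (length (shape P)) (internal P)        ≡⟨ count-lookup (shape P) ⟩
  countTrue (shape P)                          ≡⟨ m+n∸n≡m (countTrue (shape P)) (leaves P) ⟨
  countTrue (shape P) + leaves P ∸ leaves P    ≡⟨ cong (_∸ leaves P) (trans (countTrue+countFalse (shape P)) (vertex-count P)) ⟩
  suc (edges P) ∸ leaves P                     ∎

-- Plane trees with n edges and k leaves are the forests of one such tree.
TreesWith : ℕ → ℕ → Set
TreesWith n k = Σ PTree λ P → (edges P ≡ n) × (leaves P ≡ k)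

TreesWith-card : ∀ n k → TreesWith n k ↔ Fin (trees n k)
TreesWith-card n k = ↔-trans (mk↔ₛ′ singleton unsingleton singleton∘unsingleton unsingleton∘singleton) (Forests-card 1 n k)
  where
  singleton : TreesWith n k → Forests 1 n k
  singleton (P , e , l) = P ∷ [] , refl , trans (+-identityʳ _) e , trans (+-identityʳ _) l
  unsingleton : Forests 1 n k → TreesWith n k
  unsingleton (P ∷ [] , (_ , e , l)) = P , trans (sym (+-identityʳ _)) e , trans (sym (+-identityʳ _)) l
  singleton∘unsingleton : ∀ y → singleton (unsingleton y) ≡ y
  singleton∘unsingleton (P ∷ [] , p) = cong (P ∷ [] ,_) (HasStats-irrelevant _ p)
  unsingleton∘singleton : ∀ x → unsingleton (singleton x) ≡ x
  unsingleton∘singleton (P , e , l) = cong (λ q → P , q) (cong₂ _,_ (≡-irrelevant _ e) (≡-irrelevant _ l))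

Σℕ-card : ∀ N (A : ℕ → Set) (g : ℕ → ℕ) →
  (∀ k → A k ↔ Fin (g k)) → (∀ k → N ≤ k → A k → ⊥) → Σ ℕ A ↔ Fin (sumBelow N g)
Σℕ-card zero    A g A-card A-empty = empty↔ (λ { (k , a) → A-empty k z≤n a })
Σℕ-card (suc N) A g A-card A-empty = ↔-trans split-zero
  (⊎-card (A-card 0) (Σℕ-card N (λ k → A (suc k)) (λ k → g (suc k)) (λ k → A-card (suc k)) (λ k N≤k → A-empty (suc k) (s≤s N≤k))))
  where
  split-zero : Σ ℕ A ↔ (A 0 ⊎ Σ ℕ (λ k → A (suc k)))
  split-zero = mk↔ₛ′ (λ { (zero , a) → inj₁ a ; (suc k , a) → inj₂ (k , a) })
                     (λ { (inj₁ a) → zero , a ; (inj₂ (k , a)) → suc k , a })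
                     (λ { (inj₁ a) → refl ; (inj₂ (k , a)) → refl })
                     (λ { (zero , a) → refl ; (suc k , a) → refl })

Decorated : ℕ → (ℕ → ℕ) → Set
Decorated n h = Σ PTree λ P → (edges P ≡ n) × Fin (h (leaves P))

Decorated-card : ∀ n h → Decorated n h ↔ Fin (treeSum n h)
Decorated-card n h = ↔-trans by-leaves
  (Σℕ-card (suc (suc n)) _ _ (λ k → ×-card (TreesWith-card n k) ↔-refl) too-many-leaves)
  where
  by-leaves : Decorated n h ↔ Σ ℕ (λ k → TreesWith n k × Fin (h k))
  by-leaves = mk↔ₛ′ (λ { (P , e , x) → leaves P , ((P , e , refl) , x) })
                    (λ { (k , ((P , e , l) , x)) → P , e , subst (λ z → Fin (h z)) (sym l) x })
                    (λ { (k , ((P , e , refl) , x)) → refl })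
                    (λ { (P , e , x) → refl })
  too-many-leaves : ∀ k → suc (suc n) ≤ k → TreesWith n k × Fin (h k) → ⊥
  too-many-leaves k n+2≤k ((P , e , l) , _) = <⇒≱ (s≤s (subst₂ _≤_ l (cong suc e) (leaves≤vertices P))) n+2≤k

fibrewise : ∀ {A : Set} {B C : A → Set} → (∀ a → B a ↔ C a) → Σ A B ↔ Σ A C
fibrewise B↔C = Σ-↔ ↔-refl (λ {a} → B↔C a)

-- Counting (P′, M′, c′): a tree with n edges has C(n+1,2) vertex pairs.
TriplesAny-card : ∀ n → TriplesAny n ↔ Fin (choose (suc n) 2 * schroder n)
TriplesAny-card n = ↔-trans (fibrewise λ P → fibrewise λ e → decorations P e)
                            (↔-trans (Decorated-card n (λ k → choose (suc n) 2 * 2 ^ k)) (Fin-cast (treeSum-any n)))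
  where
  decorations : ∀ P → edges P ≡ n → (TwoSet P (λ _ → ⊤) × Colouring P) ↔ Fin (choose (suc n) 2 * 2 ^ leaves P)
  decorations P e = ↔-trans (×-card (Pairs-card _ (λ _ → true)) (colourings-card (leaves P)))
    (Fin-cast (cong (λ z → choose z 2 * 2 ^ leaves P) (trans (count-true _) (trans (vertex-count P) (cong suc e)))))

-- Counting (P, M, c): a tree with n+1 edges and k leaves has C(n+2−k,2)
-- pairs of internal vertices.
TriplesInternal-card : ∀ n → TriplesInternal (suc n) ↔ Fin (choose (suc n) 2 * schroder n)
TriplesInternal-card n = ↔-trans (fibrewise λ P → fibrewise λ e → decorations P e)
                                 (↔-trans (Decorated-card (suc n) (λ k → choose (suc (suc n) ∸ k) 2 * 2 ^ k))
                                          (Fin-cast (treeSum-internal n)))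
  where
  decorations : ∀ P → edges P ≡ suc n →
    (TwoSet P (λ v → T (internal P v)) × Colouring P) ↔ Fin (choose (suc (suc n) ∸ leaves P) 2 * 2 ^ leaves P)
  decorations P e = ↔-trans (×-card (Pairs-card _ (internal P)) (colourings-card (leaves P)))
    (Fin-cast (cong (λ z → choose z 2 * 2 ^ leaves P) (trans (internal-count P) (cong (λ z → suc z ∸ leaves P) e))))

theorem2p7 : (n : ℕ) → (TriplesInternal (suc n) ↔ TriplesAny n) × (TriplesInternal (suc n) ↔ Fin ((suc n C 2) * schroder n))
theorem2p7 n = ↔-trans internal-card (↔-sym any-card) , internal-card
  where
  binomial : choose (suc n) 2 * schroder n ≡ (suc n C 2) * schroder n
  binomial = cong (_* schroder n) (sym (choose≡C (suc n) 2))
  internal-card : TriplesInternal (suc n) ↔ Fin ((suc n C 2) * schroder n)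
  internal-card = ↔-trans (TriplesInternal-card n) (Fin-cast binomial)
  any-card : TriplesAny n ↔ Fin ((suc n C 2) * schroder n)
  any-card = ↔-trans (TriplesAny-card n) (Fin-cast binomial)
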